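{- For all $\lambda$-terms $t,s$: if $t\to_{\beta_v}^* s$ and $s$ is $\to_w$-normal, then $t$ is strongly $\to_w$-normalizing (there is no infinite $\to_w$-sequence from $t$).
   Context: $\lambda$-terms: $t,s::=x\mid\lambda x.t\mid ts$ (up to $\alpha$-equivalence); values $v::=x\mid\lambda x.t$; $t\{x:=s\}$ is capture-avoiding substitution. $\to_{\beta_v}$ is the closure of $(\lambda x.t)v\to_{\beta_v}t\{x:=v\}$ ($v$ a value) under abstraction and both sides of application; $\to_{\beta_v}^*$ its reflexive-transitive closure. Weak call-by-value reduction $\to_w$: $(\lambda x.t)v\to_w t\{x:=v\}$ for $v$ a value; if $t\to_w t'$ then $ts\to_w t's$ and $st\to_w st'$. A term is $\to_w$-normal if it has no $\to_w$-step. -}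

module Defs where

open import Data.Nat using (ℕ; zero; suc; _<ᵇ_)
open import Data.Bool using (if_then_else_)
open import Relation.Nullary using (¬_)
open import Relation.Binary.Construct.Closure.ReflexiveTransitive using (Star)

-- λ-terms up to α-equivalence, represented with de Bruijn indices.
data Term : Set where
  var : ℕ → Term
  lam : Term → Term
  app : Term → Term → Term

data Value : Term → Set where
  v-var : ∀ {n} → Value (var n)
  v-lam : ∀ {t} → Value (lam t)

shift : ℕ → Term → Term
shift c (var n) = if n <ᵇ c then var n else var (suc n)
shift c (lam t) = lam (shift (suc c) t)
shift c (app t s) = app (shift c t) (shift c s)

-- subst j s t : replace variable j in t by s, and decrement free variables > j
-- (this is the de Bruijn version of capture-avoiding t{x:=s} under a binder)
subst : ℕ → Term → Term → Term
subst j s (var n) with n <ᵇ j | j <ᵇ n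
... | Data.Bool.true  | _ = var n
... | Data.Bool.false | Data.Bool.true  = var (pred' n)
  where pred' : ℕ → ℕ
        pred' zero = zero
        pred' (suc m) = m
... | Data.Bool.false | Data.Bool.false = s
subst j s (lam t) = lam (subst (suc j) (shift 0 s) t)
subst j s (app t u) = app (subst j s t) (subst j s u)

-- β-contraction of (λ.t) applied to s : t{0:=s}
_[_] : Term → Term → Term
t [ s ] = subst 0 s t

data _→βv_ : Term → Term → Set where
  βv   : ∀ {t v} → Value v → app (lam t) v →βv (t [ v ])
  ξlam : ∀ {t t'} → t →βv t' → lam t →βv lam t'
  ξl   : ∀ {t t' s} → t →βv t' → app t s →βv app t' s
  ξr   : ∀ {t t' s} → t →βv t' → app s t →βv app s t'

_→βv*_ : Term → Term → Set
_→βv*_ = Star _→βv_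

data _→w_ : Term → Term → Set where
  βw  : ∀ {t v} → Value v → app (lam t) v →w (t [ v ])
  wl  : ∀ {t t' s} → t →w t' → app t s →w app t' s
  wr  : ∀ {t t' s} → t →w t' → app s t →w app s t'

w-normal : Term → Set
w-normal t = ∀ {t'} → ¬ (t →w t')

StronglyNormalizing-w : Term → Set
StronglyNormalizing-w t =
  ¬ (Σ (ℕ → Term) λ f → (f 0 ≡ t) × (∀ i → f i →w f (suc i)))
  where open import Data.Product using (Σ; _×_)
        open import Relation.Binary.PropositionalEquality using (_≡_)

-- The proof has two independent halves.
--  * Weak normalization is reflected along βv.  Every βv-step is a parallel
--    βv-reduction t ⇒ t', and every parallel reduction factorizes as some weak
--    steps followed by an internal parallel reduction t →w* u ⇛ t', one that
--    contracts no redex in weak position.  An internal reduction can be merged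
--    with a following weak step into a parallel one, and it reflects
--    →w-normality.  Together these let us pull a normalizing →w-sequence of
--    t' back to one of t, so t →βv* s with s →w-normal makes t weakly normalizing.
--  * Weak normalization implies strong normalization for →w, since →w has the
--    diamond property: every →w-step from t shortens the distance to its normal
--    form by exactly one, so no infinite →w-sequence can start at t.
module Submission where

open import Defs
open import Data.Nat using (ℕ; zero; suc; _+_; _<_; _≤_; z≤n; s≤s; _<ᵇ_)
open import Data.Nat.Properties using (_<?_; <-cmp; ≤-refl; ≤-trans; <-≤-trans; m<n⇒m<1+n; m≤n⇒m≤1+n; ≮⇒≥)
open import Data.Bool using (true; false)
open import Data.Product using (∃; ∃₂; _×_; _,_)
open import Data.Sum using (_⊎_; inj₁; inj₂)
open import Data.Empty using (⊥-elim)
open import Function using (_∘_)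
open import Relation.Nullary using (yes; no)
open import Relation.Binary.Definitions using (tri<; tri≈; tri>)
open import Relation.Binary.PropositionalEquality using (_≡_; refl; sym; trans; cong; cong₂)
open import Relation.Binary.Construct.Closure.ReflexiveTransitive using (ε; _◅_)

-- The variable
-- cases of the de Bruijn lemmas below decide every comparison the two sides
-- perform; after rewriting these boolean tests both sides compute to the same term.
<ᵇ-true : ∀ {m n} → m < n → (m <ᵇ n) ≡ true
<ᵇ-true {zero} {suc n} _ = refl
<ᵇ-true {suc m} {suc n} (s≤s p) = <ᵇ-true p

<ᵇ-false : ∀ {m n} → n ≤ m → (m <ᵇ n) ≡ false
<ᵇ-false {m} {zero} _ = refl
<ᵇ-false {suc m} {suc n} (s≤s p) = <ᵇ-false p

shift-shift : ∀ {d c} t → d ≤ c → shift (suc c) (shift d t) ≡ shift d (shift c t)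
shift-shift {d} {c} (var n) d≤c with n <? d | n <? c
... | yes n<d | _
  rewrite <ᵇ-true (<-≤-trans n<d d≤c) | <ᵇ-true n<d | <ᵇ-true (m<n⇒m<1+n (<-≤-trans n<d d≤c)) = refl
... | no n≮d | yes n<c
  rewrite <ᵇ-true n<c | <ᵇ-false (≮⇒≥ n≮d) | <ᵇ-true n<c = refl
... | no n≮d | no n≮c
  rewrite <ᵇ-false (≮⇒≥ n≮c) | <ᵇ-false (≮⇒≥ n≮d) | <ᵇ-false (≮⇒≥ n≮c)
        | <ᵇ-false (m≤n⇒m≤1+n (≮⇒≥ n≮d)) = refl
shift-shift (lam t) d≤c = cong lam (shift-shift t (s≤s d≤c))
shift-shift (app t u) d≤c = cong₂ app (shift-shift t d≤c) (shift-shift u d≤c)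

shift-subst-above : ∀ {j c} s t → j ≤ c → shift c (subst j s t) ≡ subst j (shift c s) (shift (suc c) t)
shift-subst-above {j} {c} s (var n) j≤c with <-cmp n j
... | tri< n<j _ _
  rewrite <ᵇ-true n<j | <ᵇ-true (m<n⇒m<1+n (<-≤-trans n<j j≤c)) | <ᵇ-true (<-≤-trans n<j j≤c)
        | <ᵇ-true n<j = refl
... | tri≈ _ refl _
  rewrite <ᵇ-false (≤-refl {n}) | <ᵇ-true (s≤s j≤c) | <ᵇ-false (≤-refl {n}) = refl
shift-subst-above {j} {c} s (var (suc m)) j≤c | tri> _ _ (s≤s j≤m) with m <? c
... | yes m<c
  rewrite <ᵇ-false (m≤n⇒m≤1+n j≤m) | <ᵇ-true (s≤s j≤m) | <ᵇ-true m<c | <ᵇ-false (m≤n⇒m≤1+n j≤m)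
        | <ᵇ-true (s≤s j≤m) = refl
... | no m≮c
  rewrite <ᵇ-false (m≤n⇒m≤1+n j≤m) | <ᵇ-true (s≤s j≤m) | <ᵇ-false (≮⇒≥ m≮c)
        | <ᵇ-false (m≤n⇒m≤1+n (m≤n⇒m≤1+n j≤m)) | <ᵇ-true (s≤s (m≤n⇒m≤1+n j≤m)) = refl
shift-subst-above {j} {c} s (lam t) j≤c =
  cong lam (trans (shift-subst-above (shift 0 s) t (s≤s j≤c))
                  (cong (λ s' → subst (suc j) s' (shift (suc (suc c)) t)) (shift-shift s z≤n)))
shift-subst-above s (app t u) j≤c = cong₂ app (shift-subst-above s t j≤c) (shift-subst-above s u j≤c)

shift-subst-below : ∀ {c j} s t → c ≤ j → shift c (subst j s t) ≡ subst (suc j) (shift c s) (shift c t)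
shift-subst-below {c} {j} s (var n) c≤j with <-cmp n j
... | tri< n<j _ _ with n <? c
...   | yes n<c
  rewrite <ᵇ-true n<j | <ᵇ-true n<c | <ᵇ-true (m<n⇒m<1+n n<j) = refl
...   | no n≮c
  rewrite <ᵇ-true n<j | <ᵇ-false (≮⇒≥ n≮c) | <ᵇ-true n<j = refl
shift-subst-below {c} {j} s (var n) c≤j | tri≈ _ refl _
  rewrite <ᵇ-false (≤-refl {n}) | <ᵇ-false c≤j | <ᵇ-false (≤-refl {n}) = refl
shift-subst-below {c} {j} s (var (suc m)) c≤j | tri> _ _ (s≤s j≤m)
  rewrite <ᵇ-false (m≤n⇒m≤1+n j≤m) | <ᵇ-true (s≤s j≤m) | <ᵇ-false (≤-trans c≤j j≤m)
        | <ᵇ-false (m≤n⇒m≤1+n (≤-trans c≤j j≤m)) | <ᵇ-false (m≤n⇒m≤1+n j≤m) | <ᵇ-true (s≤s j≤m) = refl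
shift-subst-below {c} {j} s (lam t) c≤j =
  cong lam (trans (shift-subst-below (shift 0 s) t (s≤s c≤j))
                  (cong (λ s' → subst (suc (suc j)) s' (shift (suc c) t)) (shift-shift s z≤n)))
shift-subst-below s (app t u) c≤j = cong₂ app (shift-subst-below s t c≤j) (shift-subst-below s u c≤j)

subst-shift : ∀ {i} u t → subst i u (shift i t) ≡ t
subst-shift {i} u (var n) with n <? i
... | yes n<i
  rewrite <ᵇ-true n<i | <ᵇ-true n<i = refl
... | no n≮i
  rewrite <ᵇ-false (≮⇒≥ n≮i) | <ᵇ-false (m≤n⇒m≤1+n (≮⇒≥ n≮i)) | <ᵇ-true (s≤s (≮⇒≥ n≮i)) = refl
subst-shift u (lam t) = cong lam (subst-shift (shift 0 u) t)
subst-shift u (app t r) = cong₂ app (subst-shift u t) (subst-shift u r)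

-- The substitution lemma, t{i:=u}{j:=s} = t{j+1:=s}{i:=u{j:=s}} in de Bruijn form.
subst-subst : ∀ {i j} s u t → i ≤ j →
              subst j s (subst i u t) ≡ subst i (subst j s u) (subst (suc j) (shift i s) t)
subst-subst {i} {j} s u (var n) i≤j with <-cmp n i
... | tri< n<i _ _
  rewrite <ᵇ-true n<i | <ᵇ-true (<-≤-trans n<i i≤j) | <ᵇ-true (m<n⇒m<1+n (<-≤-trans n<i i≤j))
        | <ᵇ-true n<i = refl
... | tri≈ _ refl _
  rewrite <ᵇ-false (≤-refl {n}) | <ᵇ-true (s≤s i≤j) | <ᵇ-false (≤-refl {n}) = refl
subst-subst {i} {j} s u (var (suc m)) i≤j | tri> _ _ (s≤s i≤m) with <-cmp m j
... | tri< m<j _ _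
  rewrite <ᵇ-false (m≤n⇒m≤1+n i≤m) | <ᵇ-true (s≤s i≤m) | <ᵇ-true m<j
        | <ᵇ-false (m≤n⇒m≤1+n i≤m) | <ᵇ-true (s≤s i≤m) = refl
... | tri≈ _ refl _
  rewrite <ᵇ-false (m≤n⇒m≤1+n i≤m) | <ᵇ-true (s≤s i≤m) | <ᵇ-false (≤-refl {m}) = sym (subst-shift _ s)
subst-subst {i} {j} s u (var (suc (suc k))) i≤j | tri> _ _ (s≤s i≤m) | tri> _ _ (s≤s j≤k)
  rewrite <ᵇ-false (m≤n⇒m≤1+n i≤m) | <ᵇ-true (s≤s i≤m) | <ᵇ-false (m≤n⇒m≤1+n j≤k) | <ᵇ-true (s≤s j≤k)
        | <ᵇ-false (m≤n⇒m≤1+n (≤-trans i≤j j≤k)) | <ᵇ-true (s≤s (≤-trans i≤j j≤k)) = refl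
subst-subst {i} {j} s u (lam t) i≤j =
  cong lam (trans (subst-subst (shift 0 s) (shift 0 u) t (s≤s i≤j))
                  (cong₂ (λ u' s' → subst (suc i) u' (subst (suc (suc j)) s' t))
                         (sym (shift-subst-below s u z≤n)) (shift-shift s z≤n)))
subst-subst s u (app t r) i≤j = cong₂ app (subst-subst s u t i≤j) (subst-subst s u r i≤j)

shift-value : ∀ {c v} → Value v → Value (shift c v)
shift-value {c} (v-var {n}) with n <ᵇ c
... | true  = v-var
... | false = v-var
shift-value v-lam = v-lam

subst-value : ∀ {j s v} → Value s → Value v → Value (subst j s v)
subst-value {j} vs (v-var {n}) with n <ᵇ j | j <ᵇ n
... | true  | _     = v-var
... | false | true  = v-var
... | false | false = vs
subst-value vs v-lam = v-lam

value-normal : ∀ {v} → Value v → w-normal v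
value-normal v-var ()
value-normal v-lam ()

infix 4 _⇒_ _⇛_

data _⇒_ : Term → Term → Set where
  p-var : ∀ {n} → var n ⇒ var n
  p-lam : ∀ {t t'} → t ⇒ t' → lam t ⇒ lam t'
  p-app : ∀ {t t' s s'} → t ⇒ t' → s ⇒ s' → app t s ⇒ app t' s'
  p-β   : ∀ {t t' v v'} → t ⇒ t' → v ⇒ v' → Value v → app (lam t) v ⇒ t' [ v' ]

-- Internal parallel reduction: a parallel reduction contracting no redex in
-- weak position, i.e. it only reduces inside λ-bodies.
data _⇛_ : Term → Term → Set where
  i-var : ∀ {n} → var n ⇛ var n
  i-lam : ∀ {t t'} → t ⇒ t' → lam t ⇛ lam t'
  i-app : ∀ {t t' s s'} → t ⇛ t' → s ⇛ s' → app t s ⇛ app t' s'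

⇒-refl : ∀ t → t ⇒ t
⇒-refl (var n)   = p-var
⇒-refl (lam t)   = p-lam (⇒-refl t)
⇒-refl (app t s) = p-app (⇒-refl t) (⇒-refl s)

→βv⊆⇒ : ∀ {t t'} → t →βv t' → t ⇒ t'
→βv⊆⇒ (βv v)     = p-β (⇒-refl _) (⇒-refl _) v
→βv⊆⇒ (ξlam st)  = p-lam (→βv⊆⇒ st)
→βv⊆⇒ (ξl st)    = p-app (→βv⊆⇒ st) (⇒-refl _)
→βv⊆⇒ (ξr st)    = p-app (⇒-refl _) (→βv⊆⇒ st)

⇛⊆⇒ : ∀ {t t'} → t ⇛ t' → t ⇒ t'
⇛⊆⇒ i-var       = p-var
⇛⊆⇒ (i-lam p)   = p-lam p
⇛⊆⇒ (i-app p q) = p-app (⇛⊆⇒ p) (⇛⊆⇒ q)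

value-⇒⊆⇛ : ∀ {v v'} → Value v → v ⇒ v' → v ⇛ v'
value-⇒⊆⇛ v-var p-var     = i-var
value-⇒⊆⇛ v-lam (p-lam p) = i-lam p

⇛-preserves-value : ∀ {t t'} → t ⇛ t' → Value t → Value t'
⇛-preserves-value i-var     v-var = v-var
⇛-preserves-value (i-lam _) v-lam = v-lam

⇛-reflects-value : ∀ {t t'} → t ⇛ t' → Value t' → Value t
⇛-reflects-value i-var     v-var = v-var
⇛-reflects-value (i-lam _) v-lam = v-lam

shift-⇒ : ∀ c {t t'} → t ⇒ t' → shift c t ⇒ shift c t'
shift-⇒ c p-var       = ⇒-refl _
shift-⇒ c (p-lam p)   = p-lam (shift-⇒ (suc c) p)
shift-⇒ c (p-app p q) = p-app (shift-⇒ c p) (shift-⇒ c q)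
shift-⇒ c (p-β {t' = t'} {v' = v'} p q v) rewrite shift-subst-above {c = c} v' t' z≤n =
  p-β (shift-⇒ (suc c) p) (shift-⇒ c q) (shift-value v)

subst-⇒ : ∀ j {t t' s s'} → t ⇒ t' → s ⇒ s' → Value s → subst j s t ⇒ subst j s' t'
subst-⇒ j (p-var {n}) ps vs with n <ᵇ j | j <ᵇ n
... | true  | _     = p-var
... | false | true  = p-var
... | false | false = ps
subst-⇒ j (p-lam p)   ps vs = p-lam (subst-⇒ (suc j) p (shift-⇒ 0 ps) (shift-value vs))
subst-⇒ j (p-app p q) ps vs = p-app (subst-⇒ j p ps vs) (subst-⇒ j q ps vs)
subst-⇒ j {s' = s'} (p-β {t' = t'} {v' = v'} p q v) ps vs rewrite subst-subst {j = j} s' v' t' z≤n =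
  p-β (subst-⇒ (suc j) p (shift-⇒ 0 ps) (shift-value vs)) (subst-⇒ j q ps vs) (subst-value vs v)

subst-⇛ : ∀ j {t t' v v'} → t ⇛ t' → v ⇛ v' → Value v → subst j v t ⇛ subst j v' t'
subst-⇛ j (i-var {n}) iv vv with n <ᵇ j | j <ᵇ n
... | true  | _     = i-var
... | false | true  = i-var
... | false | false = iv
subst-⇛ j (i-lam p)   iv vv = i-lam (subst-⇒ (suc j) p (shift-⇒ 0 (⇛⊆⇒ iv)) (shift-value vv))
subst-⇛ j (i-app p q) iv vv = i-app (subst-⇛ j p iv vv) (subst-⇛ j q iv vv)

subst-→w : ∀ j {t t' s} → t →w t' → Value s → subst j s t →w subst j s t'
subst-→w j {s = s} (βw {t = b} {v = u} vu) vs rewrite subst-subst {j = j} s u b z≤n =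
  βw (subst-value vs vu)
subst-→w j (wl st) vs = wl (subst-→w j st vs)
subst-→w j (wr st) vs = wr (subst-→w j st vs)

infix 4 _→w[_]_
infixr 5 _∷_ _++_
data _→w[_]_ : Term → ℕ → Term → Set where
  []  : ∀ {t} → t →w[ 0 ] t
  _∷_ : ∀ {n t u r} → t →w u → u →w[ n ] r → t →w[ suc n ] r

_++_ : ∀ {m n t u r} → t →w[ m ] u → u →w[ n ] r → t →w[ m + n ] r
[]         ++ seq' = seq'
(st ∷ seq) ++ seq' = st ∷ (seq ++ seq')

app-l* : ∀ {n t t' s} → t →w[ n ] t' → app t s →w[ n ] app t' s
app-l* []         = []
app-l* (st ∷ seq) = wl st ∷ app-l* seq

app-r* : ∀ {n t t' s} → t →w[ n ] t' → app s t →w[ n ] app s t'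
app-r* []         = []
app-r* (st ∷ seq) = wr st ∷ app-r* seq

subst-→w* : ∀ j {n t t' s} → t →w[ n ] t' → Value s → subst j s t →w[ n ] subst j s t'
subst-→w* j []         vs = []
subst-→w* j (st ∷ seq) vs = subst-→w j st vs ∷ subst-→w* j seq vs

data Factorization (t t' : Term) : Set where
  _⨾_ : ∀ {n u} → t →w[ n ] u → u ⇛ t' → Factorization t t'

factorize : ∀ {t t'} → t ⇒ t' → Factorization t t'
factorize p-var     = [] ⨾ i-var
factorize (p-lam p) = [] ⨾ i-lam p
factorize (p-app p q) with factorize p | factorize q
... | wp ⨾ ip | wq ⨾ iq = (app-l* wp ++ app-r* wq) ⨾ i-app ip iq
factorize (p-β p q v) with factorize p
... | wp ⨾ ip = (βw v ∷ subst-→w* 0 wp v) ⨾ subst-⇛ 0 ip (value-⇒⊆⇛ v q) v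

⇛-then-→w : ∀ {t t' t''} → t ⇛ t' → t' →w t'' → t ⇒ t''
⇛-then-→w (i-app (i-lam p) q) (βw v) = p-β p (⇛⊆⇒ q) (⇛-reflects-value q v)
⇛-then-→w (i-app p q)         (wl st) = p-app (⇛-then-→w p st) (⇛⊆⇒ q)
⇛-then-→w (i-app p q)         (wr st) = p-app (⇛⊆⇒ p) (⇛-then-→w q st)

⇛-reflects-normal : ∀ {t t'} → t ⇛ t' → w-normal t' → w-normal t
⇛-reflects-normal (i-app (i-lam _) q) nf (βw v)  = nf (βw (⇛-preserves-value q v))
⇛-reflects-normal (i-app p q)         nf (wl st) = ⇛-reflects-normal p (λ st' → nf (wl st')) st
⇛-reflects-normal (i-app p q)         nf (wr st) = ⇛-reflects-normal q (λ st' → nf (wr st')) st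

WeaklyNormalizing-w : Term → Set
WeaklyNormalizing-w t = ∃₂ λ n m → t →w[ n ] m × w-normal m

prepend-WN : ∀ {k t u} → t →w[ k ] u → WeaklyNormalizing-w u → WeaklyNormalizing-w t
prepend-WN seq (n , m , seq' , nf) = _ , m , seq ++ seq' , nf

⇛-reflects-WN : ∀ {n t t' m} → t ⇛ t' → t' →w[ n ] m → w-normal m → WeaklyNormalizing-w t
⇒-reflects-WN : ∀ {n t t' m} → t ⇒ t' → t' →w[ n ] m → w-normal m → WeaklyNormalizing-w t
⇛-reflects-WN p []         nf = 0 , _ , [] , ⇛-reflects-normal p nf
⇛-reflects-WN p (st ∷ seq) nf = ⇒-reflects-WN (⇛-then-→w p st) seq nf
⇒-reflects-WN p seq nf with factorize p
... | wp ⨾ ip = prepend-WN wp (⇛-reflects-WN ip seq nf)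

βv*-reflects-WN : ∀ {t s} → t →βv* s → w-normal s → WeaklyNormalizing-w t
βv*-reflects-WN ε          nf = 0 , _ , [] , nf
βv*-reflects-WN (st ◅ red) nf with βv*-reflects-WN red nf
... | n , m , seq , nf' = ⇒-reflects-WN (→βv⊆⇒ st) seq nf'

→w-diamond : ∀ {t u₁ u₂} → t →w u₁ → t →w u₂ → u₁ ≡ u₂ ⊎ ∃ λ u → u₁ →w u × u₂ →w u
→w-diamond (βw _)  (βw _)  = inj₁ refl
→w-diamond (βw v)  (wr st) = ⊥-elim (value-normal v st)
→w-diamond (wr st) (βw v)  = ⊥-elim (value-normal v st)
→w-diamond (wl s₁) (wr s₂) = inj₂ (_ , wr s₂ , wl s₁)
→w-diamond (wr s₁) (wl s₂) = inj₂ (_ , wl s₂ , wr s₁)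
→w-diamond (wl s₁) (wl s₂) with →w-diamond s₁ s₂
... | inj₁ refl             = inj₁ refl
... | inj₂ (u , s₁' , s₂') = inj₂ (_ , wl s₁' , wl s₂')
→w-diamond (wr s₁) (wr s₂) with →w-diamond s₁ s₂
... | inj₁ refl             = inj₁ refl
... | inj₂ (u , s₁' , s₂') = inj₂ (_ , wr s₁' , wr s₂')

step-toward-normal : ∀ {n t t' m} → t →w[ suc n ] m → w-normal m → t →w t' → t' →w[ n ] m
step-toward-normal (s₁ ∷ seq) nf s₂ with →w-diamond s₁ s₂
... | inj₁ refl = seq
... | inj₂ (u , s₁' , s₂') with seq
...   | []          = ⊥-elim (nf s₁')
...   | seq'@(_ ∷ _) = s₂' ∷ step-toward-normal seq' nf s₁'

WN⇒SN : ∀ {n t m} → t →w[ n ] m → w-normal m → StronglyNormalizing-w t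
WN⇒SN []           nf (f , refl , steps) = nf (steps 0)
WN⇒SN seq@(_ ∷ _) nf (f , refl , steps) =
  WN⇒SN (step-toward-normal seq nf (steps 0)) nf (f ∘ suc , refl , steps ∘ suc)

theorem6 : ∀ (t s : Term) → t →βv* s → w-normal s → StronglyNormalizing-w t
theorem6 t s t→s s-normal with βv*-reflects-WN t→s s-normal
... | n , m , t→m , m-normal = WN⇒SN t→m m-normal
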